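{- Let $p$ be a prime and let $n>r\geq1$ be integers; if $p=2$ assume $r\geq 2$. Let $H$ be a subgroup of $\mathrm{GL}_2(\mathbb{Z}/p^{n+1}\mathbb{Z})$ such that $\det(H)\supseteq 1+p^r\mathbb{Z}/p^{n+1}\mathbb{Z}$ and $H\supseteq(1+p^{n-r}\mathrm{M}_2(\mathbb{Z}/p^{n+1}\mathbb{Z}))^{\det=1}$. Then the restriction of $\det$ to $H\cap(1+p^n\mathrm{M}_2(\mathbb{Z}/p^{n+1}\mathbb{Z}))$ is a surjection onto $1+p^n\mathbb{Z}/p^{n+1}\mathbb{Z}$. In particular $H\supseteq 1+p^n\mathrm{M}_2(\mathbb{Z}/p^{n+1}\mathbb{Z})$.
   Context: For a set $S$ of matrices, $S^{\det=1}$ denotes its subset of determinant-$1$ elements. -}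

module Defs where

open import Data.Nat using (ℕ) renaming (_^_ to _^ℕ_)
open import Data.Integer using (ℤ; +_; _+_; _-_; _*_; 0ℤ; 1ℤ)
open import Data.Integer.Divisibility using (_∣_)
open import Data.Product using (Σ; _×_; _,_)

infix 4 _≡_[mod_] _≋_[mod_]
infixl 7 _⊗_
infixr 8 _^_

_≡_[mod_] : ℤ → ℤ → ℤ → Set
x ≡ y [mod m ] = m ∣ (x - y)

-- 2×2 integer matrices; an element of M₂(ℤ/Nℤ) is represented by any
-- integer lift, equality in M₂(ℤ/Nℤ) being entrywise congruence mod N.
record Mat : Set where
  constructor mat
  field
    a b c d : ℤ
open Mat public

_≋_[mod_] : Mat → Mat → ℤ → Set
A ≋ B [mod m ] =
  (a A ≡ a B [mod m ]) × (b A ≡ b B [mod m ]) ×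
  (c A ≡ c B [mod m ]) × (d A ≡ d B [mod m ])

I₂ : Mat
I₂ = mat 1ℤ 0ℤ 0ℤ 1ℤ

_⊗_ : Mat → Mat → Mat
A ⊗ B = mat (a A * a B + b A * c B) (a A * b B + b A * d B)
            (c A * a B + d A * c B) (c A * b B + d A * d B)

det : Mat → ℤ
det A = a A * d A - b A * c A

_^_ : ℕ → ℕ → ℤ
p ^ k = + (p ^ℕ k)

IsUnitMod : ℤ → ℤ → Set
IsUnitMod N x = Σ ℤ λ u → x * u ≡ 1ℤ [mod N ]

-- H is a subgroup of GL₂(ℤ/Nℤ), given as a predicate on integer lifts
-- that is well defined modulo N.
record IsSubgroupGL₂ (N : ℤ) (H : Mat → Set) : Set where
  field
    respects : ∀ {A B} → A ≋ B [mod N ] → H A → H B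
    invertible : ∀ {A} → H A → IsUnitMod N (det A)
    has-one : H I₂
    mul-closed : ∀ {A B} → H A → H B → H (A ⊗ B)
    inv-closed : ∀ {A} → H A → Σ Mat λ B → H B × (A ⊗ B ≋ I₂ [mod N ])

module Submission where

-- Choose B ∈ H with det B ≡ 1 + p^r. By Cayley–Hamilton B^k = u_k B + v_k I, and the
-- recurrence on (u_k, v_k) is invertible mod p (det B is a unit) and never reaches (0, 0);
-- by pigeonhole B^e ≡ I (mod p) for some 0 < e < p², so B^(cp) ≡ I (mod p) with p ∤ c.
-- Lifting through p-th powers makes G = B^(c p^(n-r)) ≡ I (mod p^(n-r)). On determinants,
-- (1 + w p^k)^p ≡ 1 + w p^(k+1) (mod p^(k+2)) for every k ≥ r because r ≥ 1 (r ≥ 2 if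
-- p = 2), so det G ≡ 1 + c p^n (mod p^(n+1)). The powers of G then have every determinant
-- 1 + y p^n, and an A ≡ I (mod p^(n-r)) of that determinant is such a power times an
-- element of determinant 1, which lies in H by hypothesis.

open import Defs
open import Data.Bool using (T)
open import Data.Empty using (⊥-elim)
open import Data.Fin using (Fin; toℕ; fromℕ<; combine; punchOut)
import Data.Fin.Properties as Fin
open import Data.Integer using (ℤ; _+_; _*_; _-_; -_; 0ℤ; 1ℤ; +_) renaming (_^_ to _^ᶻ_)
open import Data.Integer.DivMod using (_%ℕ_; _/ℕ_; n%ℕd<d; a≡a%ℕn+[a/ℕn]*n)
import Data.Integer.Divisibility.Signed as Signed
import Data.Integer.Properties as ℤ
open import Data.Integer.Tactic.RingSolver using (solve; solve-∀)
open import Data.List using (_∷_; [])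
open import Data.Nat as ℕ using (ℕ; zero; suc; _≤_; _<_; _∸_; _≡ᵇ_; s≤s; z≤n; NonZero)
  renaming (_^_ to _^ℕ_)
open import Data.Nat.Coprimality using (Coprime; coprime-Bézout)
open import Data.Nat.Divisibility as ℕ using (divides; _∣?_)
open import Data.Nat.DivMod using (_%_; _/_; m≡m%n+[m/n]*n; m%n<n)
open import Data.Nat.GCD using (module Bézout)
open import Data.Nat.Primality using (Prime; prime⇒irreducible; prime⇒nonZero; prime⇒nonTrivial)
import Data.Nat.Properties as ℕ
open import Data.Product using (Σ; ∃; ∃₂; _×_; _,_)
open import Data.Sum using (_⊎_; inj₁; inj₂)
open import Function using (_∘_)
open import Relation.Binary.Bundles using (Setoid)
open import Relation.Binary.PropositionalEquality
  using (_≡_; _≢_; refl; sym; trans; cong; subst; subst₂; module ≡-Reasoning)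
open import Relation.Binary.Structures using (IsEquivalence)
open import Relation.Nullary using (¬_; yes; no)

-- The congruence of Defs hides m, x and y behind ∣ m ∣ ∣ ∣ x - y ∣, so Agda
-- cannot infer them; the proofs work with this record and convert at the end.
infix 4 _≈_[mod_]
record _≈_[mod_] (x y m : ℤ) : Set where
  constructor mkCong
  field
    quot    : ℤ
    quot-eq : x ≡ y + quot * m

≈[mod]⇒≡[mod] : ∀ {m x y} → x ≈ y [mod m ] → x ≡ y [mod m ]
≈[mod]⇒≡[mod] {m} {y = y} (mkCong k refl) =
  Signed.∣⇒∣ᵤ {m} {y + k * m - y} (Signed.divides k (solve (y ∷ k ∷ m ∷ [])))

≡[mod]⇒≈[mod] : ∀ {m x y} → x ≡ y [mod m ] → x ≈ y [mod m ]
≡[mod]⇒≈[mod] {m} {x} {y} x≡y with Signed.∣ᵤ⇒∣ x≡y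
... | Signed.divides k x-y≡km = mkCong k (begin
  x             ≡⟨ solve (x ∷ y ∷ []) ⟩
  y + (x - y)   ≡⟨ cong (λ z → y + z) x-y≡km ⟩
  y + k * m     ∎)
  where open ≡-Reasoning

module _ {m : ℤ} where

  ≈[mod]-reflexive : ∀ {x y} → x ≡ y → x ≈ y [mod m ]
  ≈[mod]-reflexive {x} refl = mkCong 0ℤ (solve (x ∷ m ∷ []))

  ≈[mod]-refl : ∀ {x} → x ≈ x [mod m ]
  ≈[mod]-refl = ≈[mod]-reflexive refl

  ≈[mod]-sym : ∀ {x y} → x ≈ y [mod m ] → y ≈ x [mod m ]
  ≈[mod]-sym {y = y} (mkCong k refl) = mkCong (- k) (solve (y ∷ k ∷ m ∷ []))

  ≈[mod]-trans : ∀ {x y z} → x ≈ y [mod m ] → y ≈ z [mod m ] → x ≈ z [mod m ]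
  ≈[mod]-trans {z = z} (mkCong k refl) (mkCong l refl) =
    mkCong (l + k) (solve (z ∷ k ∷ l ∷ m ∷ []))

  ≈[mod]-isEquivalence : IsEquivalence _≈_[mod m ]
  ≈[mod]-isEquivalence = record
    { refl = ≈[mod]-refl ; sym = ≈[mod]-sym ; trans = ≈[mod]-trans }

  +-cong-≈[mod] : ∀ {x x′ y y′} → x ≈ x′ [mod m ] → y ≈ y′ [mod m ] →
                  x + y ≈ x′ + y′ [mod m ]
  +-cong-≈[mod] {x′ = x′} {y′ = y′} (mkCong k refl) (mkCong l refl) =
    mkCong (k + l) (solve (x′ ∷ y′ ∷ k ∷ l ∷ m ∷ []))

  *-cong-≈[mod] : ∀ {x x′ y y′} → x ≈ x′ [mod m ] → y ≈ y′ [mod m ] →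
                  x * y ≈ x′ * y′ [mod m ]
  *-cong-≈[mod] {x′ = x′} {y′ = y′} (mkCong k refl) (mkCong l refl) =
    mkCong (x′ * l + k * y′ + k * l * m) (solve (x′ ∷ y′ ∷ k ∷ l ∷ m ∷ []))

  +-congˡ-≈[mod] : ∀ x {y y′} → y ≈ y′ [mod m ] → x + y ≈ x + y′ [mod m ]
  +-congˡ-≈[mod] x = +-cong-≈[mod] (≈[mod]-refl {x})

  *-congˡ-≈[mod] : ∀ x {y y′} → y ≈ y′ [mod m ] → x * y ≈ x * y′ [mod m ]
  *-congˡ-≈[mod] x = *-cong-≈[mod] (≈[mod]-refl {x})

  -‿cong-≈[mod] : ∀ {x y} → x ≈ y [mod m ] → - x ≈ - y [mod m ]
  -‿cong-≈[mod] {y = y} (mkCong k refl) = mkCong (- k) (solve (y ∷ k ∷ m ∷ []))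

  -‿cancel-≈[mod] : ∀ {x y} → - x ≈ - y [mod m ] → x ≈ y [mod m ]
  -‿cancel-≈[mod] {x} {y} =
    subst₂ _≈_[mod m ] (ℤ.neg-involutive x) (ℤ.neg-involutive y) ∘ -‿cong-≈[mod]

≈[mod]-setoid : ℤ → Setoid _ _
≈[mod]-setoid m = record { isEquivalence = ≈[mod]-isEquivalence {m} }

module ≈[mod]-Reasoning (m : ℤ) where
  open import Relation.Binary.Reasoning.Setoid (≈[mod]-setoid m) public

*-cancelˡ-≈[mod] : ∀ {m u δ x y} → δ * u ≈ 1ℤ [mod m ] → δ * x ≈ δ * y [mod m ] →
                   x ≈ y [mod m ]
*-cancelˡ-≈[mod] {m} {u} {δ} {x} {y} δu≈1 δx≈δy = begin
  x             ≡⟨ solve (x ∷ []) ⟩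
  1ℤ * x        ≈⟨ *-cong-≈[mod] (≈[mod]-sym δu≈1) ≈[mod]-refl ⟩
  δ * u * x     ≡⟨ solve (δ ∷ u ∷ x ∷ []) ⟩
  u * (δ * x)   ≈⟨ *-congˡ-≈[mod] u δx≈δy ⟩
  u * (δ * y)   ≡⟨ solve (δ ∷ u ∷ y ∷ []) ⟩
  δ * u * y     ≈⟨ *-cong-≈[mod] δu≈1 ≈[mod]-refl ⟩
  1ℤ * y        ≡⟨ solve (y ∷ []) ⟩
  y             ∎
  where open ≈[mod]-Reasoning m

≈[mod]-weaken : ∀ {m n x y} → m Signed.∣ n → x ≈ y [mod n ] → x ≈ y [mod m ]
≈[mod]-weaken {m} {y = y} (Signed.divides q refl) (mkCong k refl) =
  mkCong (k * q) (solve (y ∷ k ∷ q ∷ m ∷ []))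

*-scale-≈[mod] : ∀ {m x y} k → x ≈ y [mod m ] → x * k ≈ y * k [mod m * k ]
*-scale-≈[mod] {m} {y = y} k (mkCong l refl) = mkCong l (solve (y ∷ l ∷ m ∷ k ∷ []))

%ℕ-≈[mod] : ∀ x N .{{_ : NonZero N}} → x ≈ + (x %ℕ N) [mod + N ]
%ℕ-≈[mod] x N = mkCong (x /ℕ N) (a≡a%ℕn+[a/ℕn]*n x N)

1≉0[mod] : ∀ {N} → 1 < N → ¬ 1ℤ ≈ 0ℤ [mod + N ]
1≉0[mod] 1<N 1≈0 = ℕ.<-irrefl (sym (ℕ.∣1⇒≡1 (≈[mod]⇒≡[mod] 1≈0))) 1<N

-- Powers of p are taken in ℤ, where (+ p) ^ᶻ suc k unfolds to + p * (+ p) ^ᶻ k; this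
-- converts them to the p ^ k of Defs.
^≡^ᶻ : ∀ p k → p ^ k ≡ (+ p) ^ᶻ k
^≡^ᶻ p zero    = refl
^≡^ᶻ p (suc k) = trans (ℤ.pos-* p (p ^ℕ k)) (cong (λ i → + p * i) (^≡^ᶻ p k))

^-∣ : ∀ p {i j} → i ≤ j → p ^ i Signed.∣ p ^ j
^-∣ p {i} {j} i≤j = Signed.divides (p ^ (j ∸ i)) (begin
  + (p ^ℕ j)                        ≡⟨ cong (λ k → + (p ^ℕ k)) (sym (ℕ.m∸n+n≡m i≤j)) ⟩
  + (p ^ℕ (j ∸ i ℕ.+ i))            ≡⟨ cong +_ (ℕ.^-distribˡ-+-* p (j ∸ i) i) ⟩
  + (p ^ℕ (j ∸ i) ℕ.* p ^ℕ i)       ≡⟨ ℤ.pos-* (p ^ℕ (j ∸ i)) (p ^ℕ i) ⟩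
  p ^ (j ∸ i) * p ^ i               ∎)
  where open ≡-Reasoning

∣^ᶻ : ∀ p {k} → 1 ≤ k → + p Signed.∣ (+ p) ^ᶻ k
∣^ᶻ p {suc k} _ = Signed.divides ((+ p) ^ᶻ k) (ℤ.*-comm (+ p) _)

prime⇒≡2⊎odd : ∀ {p} → Prime p → p ≡ 2 ⊎ ∃ λ s → p ≡ suc (2 ℕ.* s)
prime⇒≡2⊎odd {p} p-prime with p % 2 | m%n<n p 2 | m≡m%n+[m/n]*n p 2
... | 0 | _ | p≡[p/2]*2 with prime⇒irreducible p-prime (divides (p / 2) p≡[p/2]*2)
...   | inj₁ ()
...   | inj₂ 2≡p = inj₁ (sym 2≡p)
prime⇒≡2⊎odd {p} p-prime | 1 | _ | p≡1+[p/2]*2 =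
  inj₂ (p / 2 , trans p≡1+[p/2]*2 (cong suc (ℕ.*-comm (p / 2) 2)))
prime⇒≡2⊎odd {p} p-prime | suc (suc _) | s≤s (s≤s ()) | _

1+*≡*⇒ℤ : ∀ {a b c d} → 1 ℕ.+ a ℕ.* b ≡ c ℕ.* d → 1ℤ + + a * + b ≡ + c * + d
1+*≡*⇒ℤ {a} {b} {c} {d} eq = begin
  1ℤ + + a * + b      ≡⟨ cong (λ i → 1ℤ + i) (sym (ℤ.pos-* a b)) ⟩
  + (1 ℕ.+ a ℕ.* b)   ≡⟨ cong +_ eq ⟩
  + (c ℕ.* d)         ≡⟨ ℤ.pos-* c d ⟩
  + c * + d           ∎
  where open ≡-Reasoning

prime∤⇒unit : ∀ {p c} → Prime p → ¬ p ℕ.∣ c → ∃ λ u → + c * u ≈ 1ℤ [mod + p ]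
prime∤⇒unit {p} {c} p-prime p∤c with coprime-Bézout coprime
  where
  coprime : Coprime c p
  coprime (d∣c , d∣p) with prime⇒irreducible p-prime d∣p
  ... | inj₁ d≡1 = d≡1
  ... | inj₂ refl = ⊥-elim (p∤c d∣c)
... | Bézout.+- x y 1+yp≡xc =
  + x , mkCong (+ y) (trans (ℤ.*-comm (+ c) (+ x)) (sym (1+*≡*⇒ℤ {y} {p} {x} {c} 1+yp≡xc)))
... | Bézout.-+ x y 1+xc≡yp = - + x , mkCong (- + y) (begin
  + c * - + x               ≡⟨ negate (+ c) (+ x) ⟩
  1ℤ - (1ℤ + + x * + c)     ≡⟨ cong (λ i → 1ℤ - i) (1+*≡*⇒ℤ {x} {c} {y} {p} 1+xc≡yp) ⟩
  1ℤ - + y * + p            ≡⟨ regroup (+ y) (+ p) ⟩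
  1ℤ + - + y * + p          ∎)
  where
  open ≡-Reasoning
  negate : ∀ c x → c * - x ≡ 1ℤ - (1ℤ + x * c)
  negate = solve-∀
  regroup : ∀ y p → 1ℤ - y * p ≡ 1ℤ + - y * p
  regroup = solve-∀

<p²⇒∣*p : ∀ {p e} → Prime p → 0 < e → e < p ℕ.* p → ∃ λ c → ¬ p ℕ.∣ c × e ℕ.∣ c ℕ.* p
<p²⇒∣*p {p} {e} p-prime e>0 e<p² with p ∣? e
... | no p∤e = e , p∤e , ℕ.m∣m*n p
... | yes (divides zero refl) = ⊥-elim (ℕ.<-irrefl refl e>0)
... | yes (divides c@(suc _) refl) = c , p∤c , ℕ.∣-refl
  where
  p∤c : ¬ p ℕ.∣ c
  p∤c p∣c = ℕ.<⇒≱ e<p² (ℕ.*-monoˡ-≤ p (ℕ.∣⇒≤ p∣c))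

infixl 6 _⊕_
infixr 7 _·_
infixr 8 _⊗^_

_⊕_ : Mat → Mat → Mat
A ⊕ B = mat (a A + a B) (b A + b B) (c A + c B) (d A + d B)

_·_ : ℤ → Mat → Mat
s · A = mat (s * a A) (s * b A) (s * c A) (s * d A)

_⊗^_ : Mat → ℕ → Mat
A ⊗^ zero  = I₂
A ⊗^ suc k = A ⊗ A ⊗^ k

mat-cong : ∀ {a₁ b₁ c₁ d₁ a₂ b₂ c₂ d₂} → a₁ ≡ a₂ → b₁ ≡ b₂ → c₁ ≡ c₂ → d₁ ≡ d₂ →
           mat a₁ b₁ c₁ d₁ ≡ mat a₂ b₂ c₂ d₂
mat-cong refl refl refl refl = refl

⊗-assoc : ∀ A B C → (A ⊗ B) ⊗ C ≡ A ⊗ (B ⊗ C)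
⊗-assoc (mat a₁ b₁ c₁ d₁) (mat a₂ b₂ c₂ d₂) (mat a₃ b₃ c₃ d₃) =
  mat-cong (entry a₁ b₁ a₂ b₂ c₂ d₂ a₃ c₃) (entry a₁ b₁ a₂ b₂ c₂ d₂ b₃ d₃)
           (entry c₁ d₁ a₂ b₂ c₂ d₂ a₃ c₃) (entry c₁ d₁ a₂ b₂ c₂ d₂ b₃ d₃)
  where
  entry : ∀ x y a₂ b₂ c₂ d₂ z w → (x * a₂ + y * c₂) * z + (x * b₂ + y * d₂) * w
                                  ≡ x * (a₂ * z + b₂ * w) + y * (c₂ * z + d₂ * w)
  entry = solve-∀

⊗-identityˡ : ∀ A → I₂ ⊗ A ≡ A
⊗-identityˡ (mat a₁ b₁ c₁ d₁) = mat-cong (first a₁ c₁) (first b₁ d₁) (second a₁ c₁) (second b₁ d₁)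
  where
  first : ∀ x y → 1ℤ * x + 0ℤ * y ≡ x
  first = solve-∀
  second : ∀ x y → 0ℤ * x + 1ℤ * y ≡ y
  second = solve-∀

⊗-identityʳ : ∀ A → A ⊗ I₂ ≡ A
⊗-identityʳ (mat a₁ b₁ c₁ d₁) = mat-cong (first a₁ b₁) (second a₁ b₁) (first c₁ d₁) (second c₁ d₁)
  where
  first : ∀ x y → x * 1ℤ + y * 0ℤ ≡ x
  first = solve-∀
  second : ∀ x y → x * 0ℤ + y * 1ℤ ≡ y
  second = solve-∀

det-⊗ : ∀ A B → det (A ⊗ B) ≡ det A * det B
det-⊗ (mat a₁ b₁ c₁ d₁) (mat a₂ b₂ c₂ d₂) = identity a₁ b₁ c₁ d₁ a₂ b₂ c₂ d₂
  where
  identity : ∀ a₁ b₁ c₁ d₁ a₂ b₂ c₂ d₂ →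
    (a₁ * a₂ + b₁ * c₂) * (c₁ * b₂ + d₁ * d₂) - (a₁ * b₂ + b₁ * d₂) * (c₁ * a₂ + d₁ * c₂)
    ≡ (a₁ * d₁ - b₁ * c₁) * (a₂ * d₂ - b₂ * c₂)
  identity = solve-∀

⊗^-+ : ∀ A i j → A ⊗^ (i ℕ.+ j) ≡ A ⊗^ i ⊗ A ⊗^ j
⊗^-+ A zero    j = sym (⊗-identityˡ (A ⊗^ j))
⊗^-+ A (suc i) j = trans (cong (A ⊗_) (⊗^-+ A i j)) (sym (⊗-assoc A (A ⊗^ i) (A ⊗^ j)))

⊗^-*-assoc : ∀ A i j → (A ⊗^ i) ⊗^ j ≡ A ⊗^ (i ℕ.* j)
⊗^-*-assoc A i zero    = cong (A ⊗^_) (sym (ℕ.*-zeroʳ i))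
⊗^-*-assoc A i (suc j) = begin
  A ⊗^ i ⊗ (A ⊗^ i) ⊗^ j   ≡⟨ cong (A ⊗^ i ⊗_) (⊗^-*-assoc A i j) ⟩
  A ⊗^ i ⊗ A ⊗^ (i ℕ.* j)  ≡⟨ sym (⊗^-+ A i (i ℕ.* j)) ⟩
  A ⊗^ (i ℕ.+ i ℕ.* j)     ≡⟨ cong (A ⊗^_) (sym (ℕ.*-suc i j)) ⟩
  A ⊗^ (i ℕ.* suc j)       ∎
  where open ≡-Reasoning

det-⊗^ : ∀ A k → det (A ⊗^ k) ≡ det A ^ᶻ k
det-⊗^ A zero    = refl
det-⊗^ A (suc k) = trans (det-⊗ A (A ⊗^ k)) (cong (det A *_) (det-⊗^ A k))

infix 4 _≈ₘ_[mod_]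
record _≈ₘ_[mod_] (A B : Mat) (m : ℤ) : Set where
  constructor mkCongₘ
  field
    a-cong : a A ≈ a B [mod m ]
    b-cong : b A ≈ b B [mod m ]
    c-cong : c A ≈ c B [mod m ]
    d-cong : d A ≈ d B [mod m ]

≈ₘ[mod]⇒≋[mod] : ∀ {m A B} → A ≈ₘ B [mod m ] → A ≋ B [mod m ]
≈ₘ[mod]⇒≋[mod] (mkCongₘ a≈ b≈ c≈ d≈) =
  ≈[mod]⇒≡[mod] a≈ , ≈[mod]⇒≡[mod] b≈ , ≈[mod]⇒≡[mod] c≈ , ≈[mod]⇒≡[mod] d≈

≋[mod]⇒≈ₘ[mod] : ∀ {m A B} → A ≋ B [mod m ] → A ≈ₘ B [mod m ]
≋[mod]⇒≈ₘ[mod] (a≡ , b≡ , c≡ , d≡) =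
  mkCongₘ (≡[mod]⇒≈[mod] a≡) (≡[mod]⇒≈[mod] b≡) (≡[mod]⇒≈[mod] c≡) (≡[mod]⇒≈[mod] d≡)

module _ {m : ℤ} where

  ≈ₘ[mod]-reflexive : ∀ {A B} → A ≡ B → A ≈ₘ B [mod m ]
  ≈ₘ[mod]-reflexive refl = mkCongₘ ≈[mod]-refl ≈[mod]-refl ≈[mod]-refl ≈[mod]-refl

  ≈ₘ[mod]-sym : ∀ {A B} → A ≈ₘ B [mod m ] → B ≈ₘ A [mod m ]
  ≈ₘ[mod]-sym (mkCongₘ a≈ b≈ c≈ d≈) =
    mkCongₘ (≈[mod]-sym a≈) (≈[mod]-sym b≈) (≈[mod]-sym c≈) (≈[mod]-sym d≈)

  ≈ₘ[mod]-trans : ∀ {A B C} → A ≈ₘ B [mod m ] → B ≈ₘ C [mod m ] → A ≈ₘ C [mod m ]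
  ≈ₘ[mod]-trans (mkCongₘ a≈ b≈ c≈ d≈) (mkCongₘ a≈′ b≈′ c≈′ d≈′) =
    mkCongₘ (≈[mod]-trans a≈ a≈′) (≈[mod]-trans b≈ b≈′)
            (≈[mod]-trans c≈ c≈′) (≈[mod]-trans d≈ d≈′)

  ≈ₘ[mod]-isEquivalence : IsEquivalence _≈ₘ_[mod m ]
  ≈ₘ[mod]-isEquivalence = record
    { refl = ≈ₘ[mod]-reflexive refl ; sym = ≈ₘ[mod]-sym ; trans = ≈ₘ[mod]-trans }

  ⊗-cong-≈ₘ[mod] : ∀ {A A′ B B′} → A ≈ₘ A′ [mod m ] → B ≈ₘ B′ [mod m ] →
                   A ⊗ B ≈ₘ A′ ⊗ B′ [mod m ]
  ⊗-cong-≈ₘ[mod] (mkCongₘ a≈ b≈ c≈ d≈) (mkCongₘ a≈′ b≈′ c≈′ d≈′) = mkCongₘ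
    (+-cong-≈[mod] (*-cong-≈[mod] a≈ a≈′) (*-cong-≈[mod] b≈ c≈′))
    (+-cong-≈[mod] (*-cong-≈[mod] a≈ b≈′) (*-cong-≈[mod] b≈ d≈′))
    (+-cong-≈[mod] (*-cong-≈[mod] c≈ a≈′) (*-cong-≈[mod] d≈ c≈′))
    (+-cong-≈[mod] (*-cong-≈[mod] c≈ b≈′) (*-cong-≈[mod] d≈ d≈′))

  ⊗-congˡ-≈ₘ[mod] : ∀ A {B B′} → B ≈ₘ B′ [mod m ] → A ⊗ B ≈ₘ A ⊗ B′ [mod m ]
  ⊗-congˡ-≈ₘ[mod] A = ⊗-cong-≈ₘ[mod] (≈ₘ[mod]-reflexive {A} refl)

  det-cong-≈ₘ[mod] : ∀ {A B} → A ≈ₘ B [mod m ] → det A ≈ det B [mod m ]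
  det-cong-≈ₘ[mod] (mkCongₘ a≈ b≈ c≈ d≈) =
    +-cong-≈[mod] (*-cong-≈[mod] a≈ d≈) (-‿cong-≈[mod] (*-cong-≈[mod] b≈ c≈))

  ⊗^-≈ₘI₂ : ∀ {A} k → A ≈ₘ I₂ [mod m ] → A ⊗^ k ≈ₘ I₂ [mod m ]
  ⊗^-≈ₘI₂ zero    A≈I = ≈ₘ[mod]-reflexive refl
  ⊗^-≈ₘI₂ (suc k) A≈I = ≈ₘ[mod]-trans (⊗-cong-≈ₘ[mod] A≈I (⊗^-≈ₘI₂ k A≈I))
                                       (≈ₘ[mod]-reflexive (⊗-identityˡ I₂))

≈ₘ[mod]-setoid : ℤ → Setoid _ _
≈ₘ[mod]-setoid m = record { isEquivalence = ≈ₘ[mod]-isEquivalence {m} }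

module ≈ₘ[mod]-Reasoning (m : ℤ) where
  open import Relation.Binary.Reasoning.Setoid (≈ₘ[mod]-setoid m) public

≈ₘ[mod]-weaken : ∀ {m n A B} → m Signed.∣ n → A ≈ₘ B [mod n ] → A ≈ₘ B [mod m ]
≈ₘ[mod]-weaken m∣n (mkCongₘ a≈ b≈ c≈ d≈) = mkCongₘ
  (≈[mod]-weaken m∣n a≈) (≈[mod]-weaken m∣n b≈) (≈[mod]-weaken m∣n c≈) (≈[mod]-weaken m∣n d≈)

⊗^-≈ₘI₂-∣ : ∀ {m A e f} → A ⊗^ e ≈ₘ I₂ [mod m ] → e ℕ.∣ f → A ⊗^ f ≈ₘ I₂ [mod m ]
⊗^-≈ₘI₂-∣ {A = A} {e} Aᵉ≈I (divides q refl) =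
  subst (λ M → M ≈ₘ I₂ [mod _ ]) (trans (⊗^-*-assoc A e q) (cong (A ⊗^_) (ℕ.*-comm e q)))
        (⊗^-≈ₘI₂ q Aᵉ≈I)

-- Truncated binomial expansions and lifting through p-th powers

^-≈1+[mod] : ∀ {q m x w} → q Signed.∣ m → x ≈ 1ℤ + w * m [mod q * m ] →
             ∀ j → x ^ᶻ j ≈ 1ℤ + + j * w * m [mod q * m ]
^-≈1+[mod] {q} {w = w} (Signed.divides m₀ refl) _ zero =
  ≈[mod]-reflexive (identity w m₀ q)
  where
  identity : ∀ w m₀ q → 1ℤ ≡ 1ℤ + + 0 * w * (m₀ * q)
  identity = solve-∀
^-≈1+[mod] {q} {x = x} {w} (Signed.divides m₀ refl) x≈ (suc j) = begin
  x * x ^ᶻ j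
    ≈⟨ *-cong-≈[mod] x≈ (^-≈1+[mod] (Signed.divides m₀ refl) x≈ j) ⟩
  (1ℤ + w * m) * (1ℤ + + j * w * m)
    ≈⟨ mkCong (+ j * w * w * m₀) (expand (+ j) w m₀ q) ⟩
  1ℤ + + suc j * w * m
    ∎
  where
  open ≈[mod]-Reasoning (q * (m₀ * q))
  m = m₀ * q
  expand : ∀ J w m₀ q → (1ℤ + w * (m₀ * q)) * (1ℤ + J * w * (m₀ * q))
           ≡ 1ℤ + (1ℤ + J) * w * (m₀ * q) + J * w * w * m₀ * (q * (m₀ * q))
  expand = solve-∀

I₂⊕·≈ₘI₂ : ∀ q Y → I₂ ⊕ q · Y ≈ₘ I₂ [mod q ]
I₂⊕·≈ₘI₂ q (mat y₁ y₂ y₃ y₄) =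
  mkCongₘ (mkCong y₁ (diagonal q y₁)) (mkCong y₂ (off-diagonal q y₂))
          (mkCong y₃ (off-diagonal q y₃)) (mkCong y₄ (diagonal q y₄))
  where
  diagonal : ∀ q y → 1ℤ + q * y ≡ 1ℤ + y * q
  diagonal = solve-∀
  off-diagonal : ∀ q y → 0ℤ + q * y ≡ 0ℤ + y * q
  off-diagonal = solve-∀

≈ₘI₂⇒≡I₂⊕· : ∀ {q A} → A ≈ₘ I₂ [mod q ] → ∃ λ Y → A ≡ I₂ ⊕ q · Y
≈ₘI₂⇒≡I₂⊕· {q} (mkCongₘ (mkCong y₁ refl) (mkCong y₂ refl) (mkCong y₃ refl) (mkCong y₄ refl)) =
  mat y₁ y₂ y₃ y₄ ,
  mat-cong (cong (λ z → 1ℤ + z) (ℤ.*-comm y₁ q)) (cong (λ z → 0ℤ + z) (ℤ.*-comm y₂ q))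
           (cong (λ z → 0ℤ + z) (ℤ.*-comm y₃ q)) (cong (λ z → 1ℤ + z) (ℤ.*-comm y₄ q))

I₂⊕·-⊗^ : ∀ q Y j → (I₂ ⊕ q · Y) ⊗^ j ≈ₘ I₂ ⊕ (+ j * q) · Y [mod q * q ]
I₂⊕·-⊗^ q (mat y₁ y₂ y₃ y₄) zero =
  mkCongₘ (mkCong 0ℤ (diagonal q y₁)) (mkCong 0ℤ (off-diagonal q y₂))
          (mkCong 0ℤ (off-diagonal q y₃)) (mkCong 0ℤ (diagonal q y₄))
  where
  diagonal : ∀ q y → 1ℤ ≡ 1ℤ + (+ 0 * q) * y + 0ℤ * (q * q)
  diagonal = solve-∀
  off-diagonal : ∀ q y → 0ℤ ≡ 0ℤ + (+ 0 * q) * y + 0ℤ * (q * q)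
  off-diagonal = solve-∀
I₂⊕·-⊗^ q Y@(mat y₁ y₂ y₃ y₄) (suc j) = begin
  (I₂ ⊕ q · Y) ⊗ (I₂ ⊕ q · Y) ⊗^ j
    ≈⟨ ⊗-congˡ-≈ₘ[mod] (I₂ ⊕ q · Y) (I₂⊕·-⊗^ q Y j) ⟩
  (I₂ ⊕ q · Y) ⊗ (I₂ ⊕ (+ j * q) · Y)
    ≈⟨ mkCongₘ (mkCong (+ j * (y₁ * y₁ + y₂ * y₃)) (entry₁₁ q (+ j) y₁ y₂ y₃))
               (mkCong (+ j * (y₁ * y₂ + y₂ * y₄)) (entry₁₂ q (+ j) y₁ y₂ y₄))
               (mkCong (+ j * (y₃ * y₁ + y₄ * y₃)) (entry₂₁ q (+ j) y₁ y₃ y₄))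
               (mkCong (+ j * (y₃ * y₂ + y₄ * y₄)) (entry₂₂ q (+ j) y₄ y₃ y₂)) ⟩
  I₂ ⊕ (+ suc j * q) · Y
    ∎
  where
  open ≈ₘ[mod]-Reasoning (q * q)
  entry₁₁ : ∀ q J x y z → (1ℤ + q * x) * (1ℤ + (J * q) * x) + (0ℤ + q * y) * (0ℤ + (J * q) * z)
                          ≡ 1ℤ + ((1ℤ + J) * q) * x + J * (x * x + y * z) * (q * q)
  entry₁₁ = solve-∀
  entry₁₂ : ∀ q J x y z → (1ℤ + q * x) * (0ℤ + (J * q) * y) + (0ℤ + q * y) * (1ℤ + (J * q) * z)
                          ≡ 0ℤ + ((1ℤ + J) * q) * y + J * (x * y + y * z) * (q * q)
  entry₁₂ = solve-∀
  entry₂₁ : ∀ q J x y z → (0ℤ + q * y) * (1ℤ + (J * q) * x) + (1ℤ + q * z) * (0ℤ + (J * q) * y)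
                          ≡ 0ℤ + ((1ℤ + J) * q) * y + J * (y * x + z * y) * (q * q)
  entry₂₁ = solve-∀
  entry₂₂ : ∀ q J x y z → (0ℤ + q * y) * (0ℤ + (J * q) * z) + (1ℤ + q * x) * (1ℤ + (J * q) * x)
                          ≡ 1ℤ + ((1ℤ + J) * q) * x + J * (y * z + x * x) * (q * q)
  entry₂₂ = solve-∀

⊗^p-lift : ∀ p {m A} → A ≈ₘ I₂ [mod + p * m ] → A ⊗^ p ≈ₘ I₂ [mod + p * (+ p * m) ]
⊗^p-lift p {m} A≈I with ≈ₘI₂⇒≡I₂⊕· A≈I
... | Y , refl = ≈ₘ[mod]-trans
  (≈ₘ[mod]-weaken (Signed.divides m (square (+ p) m)) (I₂⊕·-⊗^ (+ p * m) Y p))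
  (I₂⊕·≈ₘI₂ (+ p * (+ p * m)) Y)
  where
  square : ∀ p m → (p * m) * (p * m) ≡ m * (p * (p * m))
  square = solve-∀

⊗^p^-lift : ∀ p j {k A} → A ≈ₘ I₂ [mod (+ p) ^ᶻ suc k ] →
            A ⊗^ (p ^ℕ j) ≈ₘ I₂ [mod (+ p) ^ᶻ (suc k ℕ.+ j) ]
⊗^p^-lift p zero {k} {A} A≈I =
  subst (λ i → A ⊗ I₂ ≈ₘ I₂ [mod (+ p) ^ᶻ i ]) (sym (ℕ.+-identityʳ (suc k)))
        (≈ₘ[mod]-trans (≈ₘ[mod]-reflexive (⊗-identityʳ A)) A≈I)
⊗^p^-lift p (suc j) {k} {A} A≈I =
  subst₂ (λ M i → M ≈ₘ I₂ [mod (+ p) ^ᶻ i ]) (⊗^-*-assoc A p (p ^ℕ j)) (sym (ℕ.+-suc (suc k) j))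
    (⊗^p^-lift p j {suc k} (⊗^p-lift p A≈I))

1+-^-odd : ∀ s e → (1ℤ + e) ^ᶻ suc (2 ℕ.* s)
                   ≈ 1ℤ + (1ℤ + + 2 * + s) * e * (1ℤ + + s * e) [mod e * e * e ]
1+-^-odd zero e = mkCong 0ℤ (identity e)
  where
  identity : ∀ e → (1ℤ + e) * 1ℤ ≡ 1ℤ + (1ℤ + + 2 * + 0) * e * (1ℤ + + 0 * e) + 0ℤ * (e * e * e)
  identity = solve-∀
1+-^-odd (suc s) e = begin
  (1ℤ + e) ^ᶻ suc (2 ℕ.* suc s)
    ≡⟨ cong (λ n → (1ℤ + e) ^ᶻ suc n) (ℕ.*-suc 2 s) ⟩
  (1ℤ + e) * ((1ℤ + e) * (1ℤ + e) ^ᶻ suc (2 ℕ.* s))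
    ≈⟨ *-congˡ-≈[mod] (1ℤ + e) (*-congˡ-≈[mod] (1ℤ + e) (1+-^-odd s e)) ⟩
  (1ℤ + e) * ((1ℤ + e) * (1ℤ + P * e * (1ℤ + S * e)))
    ≈⟨ mkCong (+ 2 * P * S + P + P * S * e) (expand S e) ⟩
  1ℤ + (1ℤ + + 2 * + suc s) * e * (1ℤ + + suc s * e)
    ∎
  where
  open ≈[mod]-Reasoning (e * e * e)
  S = + s
  P = 1ℤ + + 2 * S
  expand : ∀ S e → (1ℤ + e) * ((1ℤ + e) * (1ℤ + (1ℤ + + 2 * S) * e * (1ℤ + S * e)))
    ≡ 1ℤ + (1ℤ + + 2 * (1ℤ + S)) * e * (1ℤ + (1ℤ + S) * e)
      + (+ 2 * (1ℤ + + 2 * S) * S + (1ℤ + + 2 * S) + (1ℤ + + 2 * S) * S * e) * (e * e * e)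
  expand = solve-∀

-- The odd prime P is passed with its defining equation so that the ring solver sees 1 + 2s.
^odd-lift : ∀ s {P m₀ x w} → P ≡ 1ℤ + + 2 * + s →
            x ≈ 1ℤ + w * (P * m₀) [mod P * (P * m₀) ] →
            x ^ᶻ suc (2 ℕ.* s) ≈ 1ℤ + w * (P * (P * m₀)) [mod P * (P * (P * m₀)) ]
^odd-lift s {m₀ = m₀} {w = w} refl (mkCong z refl) = begin
  (1ℤ + w * (P * m₀) + z * (P * (P * m₀))) ^ᶻ suc (2 ℕ.* s)
    ≡⟨ cong (_^ᶻ suc (2 ℕ.* s)) (regroup w z P m₀) ⟩
  (1ℤ + e) ^ᶻ suc (2 ℕ.* s)
    ≈⟨ ≈[mod]-weaken (Signed.divides ((w + z * P) * (w + z * P) * (w + z * P) * m₀ * m₀)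
                                     (cube w z P m₀))
                     (1+-^-odd s e) ⟩
  1ℤ + P * e * (1ℤ + + s * e)
    ≈⟨ mkCong (z + + s * (w + z * P) * (w + z * P) * m₀) (reduce (+ s) w z m₀) ⟩
  1ℤ + w * (P * (P * m₀))
    ∎
  where
  P = 1ℤ + + 2 * + s
  open ≈[mod]-Reasoning (P * (P * (P * m₀)))
  e = (w + z * P) * (P * m₀)
  regroup : ∀ w z P m₀ → 1ℤ + w * (P * m₀) + z * (P * (P * m₀)) ≡ 1ℤ + (w + z * P) * (P * m₀)
  regroup = solve-∀
  cube : ∀ w z P m₀ → (w + z * P) * (P * m₀) * ((w + z * P) * (P * m₀)) * ((w + z * P) * (P * m₀))
         ≡ (w + z * P) * (w + z * P) * (w + z * P) * m₀ * m₀ * (P * (P * (P * m₀)))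
  cube = solve-∀
  reduce : ∀ S w z m₀ → let P = 1ℤ + + 2 * S; e = (w + z * P) * (P * m₀) in
    1ℤ + P * e * (1ℤ + S * e)
    ≡ 1ℤ + w * (P * (P * m₀)) + (z + S * (w + z * P) * (w + z * P) * m₀) * (P * (P * (P * m₀)))
  reduce = solve-∀

^2-lift : ∀ {m₀ x w} → x ≈ 1ℤ + w * (+ 2 * (+ 2 * m₀)) [mod + 2 * (+ 2 * (+ 2 * m₀)) ] →
          x ^ᶻ 2 ≈ 1ℤ + w * (+ 2 * (+ 2 * (+ 2 * m₀))) [mod + 2 * (+ 2 * (+ 2 * (+ 2 * m₀))) ]
^2-lift {m₀} {w = w} (mkCong z refl) =
  mkCong (z + (w + + 2 * z) * (w + + 2 * z) * m₀) (square w z m₀)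
  where
  square : ∀ w z m₀ → let x = 1ℤ + w * (+ 2 * (+ 2 * m₀)) + z * (+ 2 * (+ 2 * (+ 2 * m₀))) in
    x * (x * 1ℤ) ≡ 1ℤ + w * (+ 2 * (+ 2 * (+ 2 * m₀)))
                   + (z + (w + + 2 * z) * (w + + 2 * z) * m₀) * (+ 2 * (+ 2 * (+ 2 * (+ 2 * m₀))))
  square = solve-∀

-- Orders in GL₂(ℤ/Nℤ)

module GL₂-Order (N′ : ℕ) (B : Mat) {u : ℤ} (δu≈1 : det B * u ≈ 1ℤ [mod + suc (suc N′) ]) where

  N : ℕ
  N = suc (suc N′)

  t : ℤ
  t = a B + d B

  chStep : ℤ × ℤ → ℤ × ℤ
  chStep (x , y) = t * x + y , - (det B * x)

  chSeq : ℕ → ℤ × ℤ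
  chSeq zero    = 0ℤ , 1ℤ
  chSeq (suc k) = chStep (chSeq k)

  chMat : ℤ × ℤ → Mat
  chMat (x , y) = x · B ⊕ y · I₂

  ⊗-chMat : ∀ s → B ⊗ chMat s ≡ chMat (chStep s)
  ⊗-chMat (x , y) = mat-cong (e₁₁ (a B) (b B) (c B) (d B) x y) (e₁₂ (a B) (b B) (c B) (d B) x y)
                             (e₂₁ (a B) (b B) (c B) (d B) x y) (e₂₂ (a B) (b B) (c B) (d B) x y)
    where
    e₁₁ : ∀ a b c d x y → a * (x * a + y * 1ℤ) + b * (x * c + y * 0ℤ)
                          ≡ ((a + d) * x + y) * a + - ((a * d - b * c) * x) * 1ℤ
    e₁₁ = solve-∀
    e₁₂ : ∀ a b c d x y → a * (x * b + y * 0ℤ) + b * (x * d + y * 1ℤ)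
                          ≡ ((a + d) * x + y) * b + - ((a * d - b * c) * x) * 0ℤ
    e₁₂ = solve-∀
    e₂₁ : ∀ a b c d x y → c * (x * a + y * 1ℤ) + d * (x * c + y * 0ℤ)
                          ≡ ((a + d) * x + y) * c + - ((a * d - b * c) * x) * 0ℤ
    e₂₁ = solve-∀
    e₂₂ : ∀ a b c d x y → c * (x * b + y * 0ℤ) + d * (x * d + y * 1ℤ)
                          ≡ ((a + d) * x + y) * d + - ((a * d - b * c) * x) * 1ℤ
    e₂₂ = solve-∀

  ⊗^-chSeq : ∀ k → B ⊗^ k ≡ chMat (chSeq k)
  ⊗^-chSeq zero = mat-cong (one (a B)) (zero′ (b B)) (zero′ (c B)) (one (d B))
    where
    one : ∀ x → 1ℤ ≡ 0ℤ * x + 1ℤ * 1ℤ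
    one = solve-∀
    zero′ : ∀ x → 0ℤ ≡ 0ℤ * x + 1ℤ * 0ℤ
    zero′ = solve-∀
  ⊗^-chSeq (suc k) = trans (cong (B ⊗_) (⊗^-chSeq k)) (⊗-chMat (chSeq k))

  infix 4 _≈ₚ_
  _≈ₚ_ : ℤ × ℤ → ℤ × ℤ → Set
  (x , y) ≈ₚ (x′ , y′) = x ≈ x′ [mod + N ] × y ≈ y′ [mod + N ]

  chMat-cong : ∀ {s s′} → s ≈ₚ s′ → chMat s ≈ₘ chMat s′ [mod + N ]
  chMat-cong (x≈ , y≈) = mkCongₘ
    (+-cong-≈[mod] (*-cong-≈[mod] x≈ ≈[mod]-refl) (*-cong-≈[mod] y≈ ≈[mod]-refl))
    (+-cong-≈[mod] (*-cong-≈[mod] x≈ ≈[mod]-refl) (*-cong-≈[mod] y≈ ≈[mod]-refl))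
    (+-cong-≈[mod] (*-cong-≈[mod] x≈ ≈[mod]-refl) (*-cong-≈[mod] y≈ ≈[mod]-refl))
    (+-cong-≈[mod] (*-cong-≈[mod] x≈ ≈[mod]-refl) (*-cong-≈[mod] y≈ ≈[mod]-refl))

  chStep-injective : ∀ {s s′} → chStep s ≈ₚ chStep s′ → s ≈ₚ s′
  chStep-injective {x , y} {x′ , y′} (tx+y≈ , -δx≈) = x≈x′ , (begin
    y                       ≡⟨ recover t x y ⟩
    t * x + y - t * x       ≈⟨ +-cong-≈[mod] tx+y≈ (-‿cong-≈[mod] (*-congˡ-≈[mod] t x≈x′)) ⟩
    t * x′ + y′ - t * x′    ≡⟨ sym (recover t x′ y′) ⟩
    y′                      ∎)
    where
    open ≈[mod]-Reasoning (+ N)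
    x≈x′ : x ≈ x′ [mod + N ]
    x≈x′ = *-cancelˡ-≈[mod] {δ = det B} δu≈1 (-‿cancel-≈[mod] -δx≈)
    recover : ∀ t x y → y ≡ t * x + y - t * x
    recover = solve-∀

  chSeq-cancel : ∀ i e → chSeq i ≈ₚ chSeq (i ℕ.+ e) → chSeq 0 ≈ₚ chSeq e
  chSeq-cancel zero    e s≈ = s≈
  chSeq-cancel (suc i) e s≈ = chSeq-cancel i e (chStep-injective s≈)

  chSeq≉0 : ∀ k → ¬ chSeq k ≈ₚ (0ℤ , 0ℤ)
  chSeq≉0 zero    (_ , 1≈0) = 1≉0[mod] (s≤s (s≤s z≤n)) 1≈0
  chSeq≉0 (suc k) (x≈0 , y≈0) = chSeq≉0 k (chStep-injective
    (≈[mod]-trans x≈0 (≈[mod]-reflexive (sym (t0+0 t))) ,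
     ≈[mod]-trans y≈0 (≈[mod]-reflexive (sym (-δ0 (det B))))))
    where
    t0+0 : ∀ t → t * 0ℤ + 0ℤ ≡ 0ℤ
    t0+0 = solve-∀
    -δ0 : ∀ δ → - (δ * 0ℤ) ≡ 0ℤ
    -δ0 = solve-∀

  residue : ℤ → Fin N
  residue x = fromℕ< (n%ℕd<d x N)

  residue-injective : ∀ {x y} → residue x ≡ residue y → x ≈ y [mod + N ]
  residue-injective {x} {y} r≡r = ≈[mod]-trans (%ℕ-≈[mod] x N)
    (≈[mod]-trans (≈[mod]-reflexive (cong +_ x%N≡y%N)) (≈[mod]-sym (%ℕ-≈[mod] y N)))
    where
    x%N≡y%N : x %ℕ N ≡ y %ℕ N
    x%N≡y%N = trans (sym (Fin.toℕ-fromℕ< (n%ℕd<d x N)))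
                    (trans (cong toℕ r≡r) (Fin.toℕ-fromℕ< (n%ℕd<d y N)))

  code : ℤ × ℤ → Fin (N ℕ.* N)
  code (x , y) = combine (residue x) (residue y)

  code-injective : ∀ {s s′} → code s ≡ code s′ → s ≈ₚ s′
  code-injective {x , y} {x′ , y′} eq
    with rx≡ , ry≡ ← Fin.combine-injective (residue x) (residue y) (residue x′) (residue y′) eq
    = residue-injective rx≡ , residue-injective ry≡

GL₂-order : ∀ {N B u} → 1 < N → det B * u ≈ 1ℤ [mod + N ] →
            ∃ λ e → 0 < e × e < N ℕ.* N × B ⊗^ e ≈ₘ I₂ [mod + N ]
GL₂-order {suc (suc N′)} {B} (s≤s (s≤s z≤n)) δu≈1 =
  order-from-collision (Fin.pigeonhole (ℕ.n<1+n _) avoid-0)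
  where
  open GL₂-Order N′ B δu≈1
  ≈ₚ-sym : ∀ {s s′} → s ≈ₚ s′ → s′ ≈ₚ s
  ≈ₚ-sym (x≈ , y≈) = ≈[mod]-sym x≈ , ≈[mod]-sym y≈
  code₀≢code : ∀ k → code (0ℤ , 0ℤ) ≢ code (chSeq k)
  code₀≢code k eq = chSeq≉0 k (≈ₚ-sym (code-injective eq))
  avoid-0 : Fin (N ℕ.* N) → Fin (ℕ.pred (N ℕ.* N))
  avoid-0 i = punchOut (code₀≢code (toℕ i))
  order-from-collision : (∃₂ λ i j → toℕ i < toℕ j × avoid-0 i ≡ avoid-0 j) →
                         ∃ λ e → 0 < e × e < N ℕ.* N × B ⊗^ e ≈ₘ I₂ [mod + N ]
  order-from-collision (i , j , i<j , fi≡fj) =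
    e , ℕ.m<n⇒0<n∸m i<j , ℕ.≤-<-trans (ℕ.m∸n≤m (toℕ j) (toℕ i)) (Fin.toℕ<n j) , (begin
      B ⊗^ e            ≡⟨ ⊗^-chSeq e ⟩
      chMat (chSeq e)   ≈⟨ chMat-cong (≈ₚ-sym (chSeq-cancel (toℕ i) e seqᵢ≈seqⱼ)) ⟩
      chMat (chSeq 0)   ≡⟨ sym (⊗^-chSeq 0) ⟩
      I₂                ∎)
    where
    open ≈ₘ[mod]-Reasoning (+ N)
    e = toℕ j ℕ.∸ toℕ i
    seqᵢ≈seqⱼ : chSeq (toℕ i) ≈ₚ chSeq (toℕ i ℕ.+ e)
    seqᵢ≈seqⱼ = subst (λ k → chSeq (toℕ i) ≈ₚ chSeq k) (sym (ℕ.m+[n∸m]≡n (ℕ.<⇒≤ i<j)))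
      (code-injective (Fin.punchOut-injective (code₀≢code (toℕ i)) (code₀≢code (toℕ j)) fi≡fj))

-- Lifting determinants modulo powers of a prime

module _ {p : ℕ} (p-prime : Prime p) where

  ^p-lift : ∀ {k x w} → 1 ≤ k → (p ≡ 2 → 2 ≤ k) → x ≈ 1ℤ + w * (+ p) ^ᶻ k [mod (+ p) ^ᶻ suc k ] →
            x ^ᶻ p ≈ 1ℤ + w * (+ p) ^ᶻ suc k [mod (+ p) ^ᶻ suc (suc k) ]
  ^p-lift {k} {x} {w} k≥1 k≥2 x≈ with prime⇒≡2⊎odd p-prime
  ... | inj₁ refl with k≥2 refl
  ...   | s≤s {n = suc k′} (s≤s _) = ^2-lift {(+ 2) ^ᶻ k′} {x} {w} x≈
  ^p-lift {suc k′} {x} {w} (s≤s _) k≥2 x≈ | inj₂ (s , refl) =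
    ^odd-lift s {m₀ = (+ p) ^ᶻ k′} {x} {w} (odd≡ s) x≈
    where
    odd≡ : ∀ s → + suc (2 ℕ.* s) ≡ 1ℤ + + 2 * + s
    odd≡ s = trans (ℤ.pos-+ 1 (2 ℕ.* s)) (cong (λ i → 1ℤ + i) (ℤ.pos-* 2 s))

  ^p^-lift : ∀ {k x w} → 1 ≤ k → (p ≡ 2 → 2 ≤ k) → ∀ j →
             x ≈ 1ℤ + w * (+ p) ^ᶻ k [mod (+ p) ^ᶻ suc k ] →
             x ^ᶻ (p ^ℕ j) ≈ 1ℤ + w * (+ p) ^ᶻ (k ℕ.+ j) [mod (+ p) ^ᶻ suc (k ℕ.+ j) ]
  ^p^-lift {k} {x} {w} _ _ zero x≈ =
    subst₂ (λ y i → y ≈ 1ℤ + w * (+ p) ^ᶻ i [mod (+ p) ^ᶻ suc i ])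
           (sym (ℤ.^-identityʳ x)) (sym (ℕ.+-identityʳ k)) x≈
  ^p^-lift {k} {x} {w} k≥1 k≥2 (suc j) x≈ =
    subst₂ (λ y i → y ≈ 1ℤ + w * (+ p) ^ᶻ i [mod (+ p) ^ᶻ suc i ])
           (ℤ.^-*-assoc x p (p ^ℕ j)) (sym (ℕ.+-suc k j))
           (^p^-lift {suc k} {x ^ᶻ p} {w} (ℕ.m≤n⇒m≤1+n k≥1) (ℕ.m≤n⇒m≤1+n ∘ k≥2) j
                     (^p-lift {k} {x} {w} k≥1 k≥2 x≈))

  det-generator : ∀ {r B u} → 1 ≤ r → (p ≡ 2 → 2 ≤ r) → ∀ j →
    det B * u ≈ 1ℤ [mod + p ] → det B ≈ 1ℤ + 1ℤ * (+ p) ^ᶻ r [mod (+ p) ^ᶻ suc r ] →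
    ∃₂ λ c E → ¬ p ℕ.∣ c × B ⊗^ E ≈ₘ I₂ [mod (+ p) ^ᶻ suc j ] ×
               det (B ⊗^ E) ≈ 1ℤ + + c * (+ p) ^ᶻ (r ℕ.+ suc j) [mod (+ p) ^ᶻ suc (r ℕ.+ suc j) ]
  det-generator {r} {B} r≥1 r≥2 j δu≈1 δ≈
    with e , e>0 , e<p² , Bᵉ≈I ← GL₂-order (ℕ.nonTrivial⇒n>1 p {{prime⇒nonTrivial p-prime}}) δu≈1
    with c , p∤c , e∣cp ← <p²⇒∣*p p-prime e>0 e<p²
    = c , E , p∤c , Bᴱ≈I , (begin
    det (B ⊗^ E)
      ≡⟨ det-⊗^ B E ⟩
    det B ^ᶻ (c ℕ.* p ^ℕ suc j)
      ≡⟨ sym (ℤ.^-*-assoc (det B) c (p ^ℕ suc j)) ⟩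
    (det B ^ᶻ c) ^ᶻ (p ^ℕ suc j)
      ≈⟨ ^p^-lift {r} {det B ^ᶻ c} {+ c * 1ℤ} r≥1 r≥2 (suc j)
                  (^-≈1+[mod] {x = det B} {1ℤ} (∣^ᶻ p r≥1) δ≈ c) ⟩
    1ℤ + + c * 1ℤ * (+ p) ^ᶻ (r ℕ.+ suc j)
      ≡⟨ cong (λ w → 1ℤ + w * (+ p) ^ᶻ (r ℕ.+ suc j)) (ℤ.*-identityʳ (+ c)) ⟩
    1ℤ + + c * (+ p) ^ᶻ (r ℕ.+ suc j)
      ∎)
    where
    E = c ℕ.* p ^ℕ suc j
    open ≈[mod]-Reasoning ((+ p) ^ᶻ suc (r ℕ.+ suc j))
    Bᶜᵖ≈I : (B ⊗^ c) ⊗^ p ≈ₘ I₂ [mod (+ p) ^ᶻ 1 ]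
    Bᶜᵖ≈I = subst₂ (λ M m → M ≈ₘ I₂ [mod m ]) (sym (⊗^-*-assoc B c p)) (sym (ℤ.*-identityʳ (+ p)))
                   (⊗^-≈ₘI₂-∣ Bᵉ≈I e∣cp)
    Bᴱ≈I : B ⊗^ E ≈ₘ I₂ [mod (+ p) ^ᶻ suc j ]
    Bᴱ≈I = subst (λ M → M ≈ₘ I₂ [mod (+ p) ^ᶻ suc j ])
                 (trans (⊗^-*-assoc (B ⊗^ c) p (p ^ℕ j)) (⊗^-*-assoc B c (p ^ℕ suc j)))
                 (⊗^p^-lift p j {0} Bᶜᵖ≈I)

  private instance
    p≢0 : NonZero p
    p≢0 = prime⇒nonZero p-prime

  %ℕ-solves : ∀ {c u} y → + c * u ≈ 1ℤ [mod + p ] → + ((u * y) %ℕ p) * + c ≈ y [mod + p ]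
  %ℕ-solves {c} {u} y cu≈1 = begin
    + ((u * y) %ℕ p) * + c  ≈⟨ *-cong-≈[mod] (≈[mod]-sym (%ℕ-≈[mod] (u * y) p)) ≈[mod]-refl ⟩
    u * y * + c             ≡⟨ regroup u y (+ c) ⟩
    y * (+ c * u)           ≈⟨ *-congˡ-≈[mod] y cu≈1 ⟩
    y * 1ℤ                  ≡⟨ ℤ.*-identityʳ y ⟩
    y                       ∎
    where
    open ≈[mod]-Reasoning (+ p)
    regroup : ∀ u y c → u * y * c ≡ y * (c * u)
    regroup = solve-∀

  ^-hits : ∀ {c m x} → ¬ p ℕ.∣ c → + p Signed.∣ m → x ≈ 1ℤ + + c * m [mod + p * m ] →
           ∀ y → ∃ λ k → x ^ᶻ k ≈ 1ℤ + y * m [mod + p * m ]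
  ^-hits {c} {m} {x} p∤c p∣m x≈ y with prime∤⇒unit p-prime p∤c
  ... | u , cu≈1 = k , (begin
    x ^ᶻ k                ≈⟨ ^-≈1+[mod] p∣m x≈ k ⟩
    1ℤ + + k * + c * m    ≈⟨ +-congˡ-≈[mod] 1ℤ (*-scale-≈[mod] m (%ℕ-solves y cu≈1)) ⟩
    1ℤ + y * m            ∎)
    where
    open ≈[mod]-Reasoning (+ p * m)
    k = (u * y) %ℕ p

module _ {N : ℤ} {H : Mat → Set} (H-subgroup : IsSubgroupGL₂ N H) where
  open IsSubgroupGL₂ H-subgroup

  ∈-⊗^ : ∀ {A} → H A → ∀ k → H (A ⊗^ k)
  ∈-⊗^ A∈H zero    = has-one
  ∈-⊗^ A∈H (suc k) = mul-closed A∈H (∈-⊗^ A∈H k)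

  ∈-by-det : ∀ {M A B} → M Signed.∣ N →
             (∀ K → K ≋ I₂ [mod M ] → det K ≡ 1ℤ [mod N ] → H K) →
             A ≈ₘ I₂ [mod M ] → H B → B ≈ₘ I₂ [mod M ] → det B ≈ det A [mod N ] → H A
  ∈-by-det {M} {A} {B} M∣N kernel⊆H A≈I B∈H B≈I detB≈detA with inv-closed B∈H
  ... | B′ , B′∈H , BB′≋I = respects (≈ₘ[mod]⇒≋[mod] BK≈A) (mul-closed B∈H K∈H)
    where
    BB′≈I : B ⊗ B′ ≈ₘ I₂ [mod N ]
    BB′≈I = ≋[mod]⇒≈ₘ[mod] BB′≋I
    B′≈I : B′ ≈ₘ I₂ [mod M ]
    B′≈I = begin
      B′        ≡⟨ sym (⊗-identityˡ B′) ⟩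
      I₂ ⊗ B′   ≈⟨ ⊗-cong-≈ₘ[mod] (≈ₘ[mod]-sym B≈I) (≈ₘ[mod]-reflexive refl) ⟩
      B ⊗ B′    ≈⟨ ≈ₘ[mod]-weaken M∣N BB′≈I ⟩
      I₂        ∎
      where open ≈ₘ[mod]-Reasoning M
    K = B′ ⊗ A
    K≈I : K ≈ₘ I₂ [mod M ]
    K≈I = ≈ₘ[mod]-trans (⊗-cong-≈ₘ[mod] B′≈I A≈I) (≈ₘ[mod]-reflexive (⊗-identityˡ I₂))
    detK≈1 : det K ≈ 1ℤ [mod N ]
    detK≈1 = begin
      det (B′ ⊗ A)        ≡⟨ det-⊗ B′ A ⟩
      det B′ * det A      ≈⟨ *-congˡ-≈[mod] (det B′) (≈[mod]-sym detB≈detA) ⟩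
      det B′ * det B      ≡⟨ ℤ.*-comm (det B′) (det B) ⟩
      det B * det B′      ≡⟨ sym (det-⊗ B B′) ⟩
      det (B ⊗ B′)        ≈⟨ det-cong-≈ₘ[mod] BB′≈I ⟩
      1ℤ                  ∎
      where open ≈[mod]-Reasoning N
    K∈H : H K
    K∈H = kernel⊆H K (≈ₘ[mod]⇒≋[mod] K≈I) (≈[mod]⇒≡[mod] detK≈1)
    BK≈A : B ⊗ K ≈ₘ A [mod N ]
    BK≈A = begin
      B ⊗ (B′ ⊗ A)   ≡⟨ sym (⊗-assoc B B′ A) ⟩
      (B ⊗ B′) ⊗ A   ≈⟨ ⊗-cong-≈ₘ[mod] BB′≈I (≈ₘ[mod]-reflexive refl) ⟩
      I₂ ⊗ A         ≡⟨ ⊗-identityˡ A ⟩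
      A              ∎
      where open ≈ₘ[mod]-Reasoning N

module _ {p n r : ℕ} {H : Mat → Set} (p-prime : Prime p) (r≥1 : 1 ≤ r) (r<n : r < n)
         (r≥2 : p ≡ 2 → 2 ≤ r) (H-subgroup : IsSubgroupGL₂ (p ^ suc n) H)
         (det-H : ∀ x → Σ Mat λ A → H A × det A ≡ 1ℤ + p ^ r * x [mod p ^ suc n ]) where
  open IsSubgroupGL₂ H-subgroup

  private
    j = n ∸ suc r

    n∸r≡1+j : n ∸ r ≡ suc j
    n∸r≡1+j = ℕ.+-∸-assoc 1 r<n

    r+[1+j]≡n : r ℕ.+ suc j ≡ n
    r+[1+j]≡n = trans (cong (r ℕ.+_) (sym n∸r≡1+j)) (ℕ.m+[n∸m]≡n (ℕ.<⇒≤ r<n))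

    to-^ᶻ : ∀ k {x y} → x ≈ y [mod p ^ k ] → x ≈ y [mod (+ p) ^ᶻ k ]
    to-^ᶻ k = subst (λ m → _ ≈ _ [mod m ]) (^≡^ᶻ p k)

    unit-mod-p : ∀ {x u} → x * u ≡ 1ℤ [mod p ^ suc n ] → x * u ≈ 1ℤ [mod + p ]
    unit-mod-p xu≡1 =
      ≈[mod]-weaken (∣^ᶻ p {suc n} (s≤s z≤n)) (to-^ᶻ (suc n) (≡[mod]⇒≈[mod] xu≡1))

    mod-p^[1+r] : ∀ {x} → x ≡ 1ℤ + p ^ r * 1ℤ [mod p ^ suc n ] →
                  x ≈ 1ℤ + 1ℤ * (+ p) ^ᶻ r [mod (+ p) ^ᶻ suc r ]
    mod-p^[1+r] {x} x≡ = subst (λ v → x ≈ 1ℤ + v [mod (+ p) ^ᶻ suc r ])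
      (trans (ℤ.*-comm (p ^ r) 1ℤ) (cong (1ℤ *_) (^≡^ᶻ p r)))
      (to-^ᶻ (suc r) (≈[mod]-weaken (^-∣ p (s≤s (ℕ.<⇒≤ r<n))) (≡[mod]⇒≈[mod] x≡)))

    mod-p^[n∸r] : ∀ {A} → A ≈ₘ I₂ [mod (+ p) ^ᶻ suc j ] → A ≈ₘ I₂ [mod p ^ (n ∸ r) ]
    mod-p^[n∸r] {A} = subst (λ m → A ≈ₘ I₂ [mod m ])
                            (sym (trans (^≡^ᶻ p (n ∸ r)) (cong ((+ p) ^ᶻ_) n∸r≡1+j)))

    at-level-n : ∀ {x w} →
                 x ≈ 1ℤ + w * (+ p) ^ᶻ (r ℕ.+ suc j) [mod (+ p) ^ᶻ suc (r ℕ.+ suc j) ] →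
                 x ≈ 1ℤ + w * (+ p) ^ᶻ n [mod (+ p) ^ᶻ suc n ]
    at-level-n {x} {w} = subst (λ i → x ≈ 1ℤ + w * (+ p) ^ᶻ i [mod (+ p) ^ᶻ suc i ]) r+[1+j]≡n

    from-^ᶻ : ∀ {x} y → x ≈ 1ℤ + y * (+ p) ^ᶻ n [mod (+ p) ^ᶻ suc n ] →
              x ≈ 1ℤ + p ^ n * y [mod p ^ suc n ]
    from-^ᶻ {x} y = subst₂ (λ v m → x ≈ 1ℤ + v [mod m ])
      (trans (ℤ.*-comm y _) (cong (_* y) (sym (^≡^ᶻ p n)))) (sym (^≡^ᶻ p (suc n)))

  det-surjective : ∀ y → ∃ λ A → H A × A ≈ₘ I₂ [mod p ^ (n ∸ r) ] ×
                                 det A ≈ 1ℤ + p ^ n * y [mod p ^ suc n ]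
  det-surjective y =
    let B , B∈H , detB≡ = det-H 1ℤ
        u , δu≡1 = invertible B∈H
        c , E , p∤c , Bᴱ≈I , detBᴱ≈ =
          det-generator p-prime {r} {B} {u} r≥1 r≥2 j
                        (unit-mod-p {det B} δu≡1) (mod-p^[1+r] {det B} detB≡)
        k , detᴱᵏ≈ =
          ^-hits p-prime p∤c (∣^ᶻ p (ℕ.≤-trans r≥1 (ℕ.<⇒≤ r<n))) (at-level-n {w = + c} detBᴱ≈) y
    in (B ⊗^ E) ⊗^ k , ∈-⊗^ H-subgroup (∈-⊗^ H-subgroup B∈H E) k , ⊗^-≈ₘI₂ k (mod-p^[n∸r] Bᴱ≈I) ,
       from-^ᶻ y (≈[mod]-trans (≈[mod]-reflexive (det-⊗^ (B ⊗^ E) k)) detᴱᵏ≈)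

  ≈I₂⇒∈ : (∀ A → A ≋ I₂ [mod p ^ (n ∸ r) ] → det A ≡ 1ℤ [mod p ^ suc n ] → H A) →
          ∀ A y → A ≈ₘ I₂ [mod p ^ n ] → det A ≈ 1ℤ + p ^ n * y [mod p ^ suc n ] → H A
  ≈I₂⇒∈ kernel⊆H A y A≈I detA≈ =
    let B , B∈H , B≈I , detB≈ = det-surjective y
    in ∈-by-det H-subgroup (^-∣ p (ℕ.≤-trans (ℕ.m∸n≤m n r) (ℕ.n≤1+n n))) kernel⊆H
                (≈ₘ[mod]-weaken (^-∣ p (ℕ.m∸n≤m n r)) A≈I) B∈H B≈I
                (≈[mod]-trans detB≈ (≈[mod]-sym detA≈))

lemma2p6 : (p n r : ℕ) → Prime p → 1 ≤ r → r < n → (T (p ≡ᵇ 2) → 2 ≤ r) →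
    (H : Mat → Set) → IsSubgroupGL₂ (p ^ suc n) H →
    (∀ (x : ℤ) → Σ Mat λ A → H A × (det A ≡ 1ℤ + p ^ r * x [mod p ^ suc n ])) →
    (∀ (A : Mat) → A ≋ I₂ [mod p ^ (n ∸ r) ] → det A ≡ 1ℤ [mod p ^ suc n ] → H A) →
    (∀ (x : ℤ) → Σ Mat λ A → H A × (A ≋ I₂ [mod p ^ n ]) ×
        (det A ≡ 1ℤ + p ^ n * x [mod p ^ suc n ]))
    × (∀ (A : Mat) → A ≋ I₂ [mod p ^ n ] → H A)
lemma2p6 p n r p-prime r≥1 r<n r≥2 H H-subgroup det-H kernel⊆H = part₁ , part₂
  where
  ∈H : ∀ A y → A ≈ₘ I₂ [mod p ^ n ] → det A ≈ 1ℤ + p ^ n * y [mod p ^ suc n ] → H A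
  ∈H = ≈I₂⇒∈ p-prime r≥1 r<n (r≥2 ∘ ℕ.≡⇒≡ᵇ p 2) H-subgroup det-H kernel⊆H
  part₁ : ∀ y → Σ Mat λ A → H A × (A ≋ I₂ [mod p ^ n ]) × (det A ≡ 1ℤ + p ^ n * y [mod p ^ suc n ])
  part₁ y = D , ∈H D y D≈I detD≈ , ≈ₘ[mod]⇒≋[mod] D≈I , ≈[mod]⇒≡[mod] detD≈
    where
    D = mat (1ℤ + p ^ n * y) 0ℤ 0ℤ 1ℤ
    D≈I : D ≈ₘ I₂ [mod p ^ n ]
    D≈I = mkCongₘ (mkCong y (cong (λ i → 1ℤ + i) (ℤ.*-comm (p ^ n) y)))
                  ≈[mod]-refl ≈[mod]-refl ≈[mod]-refl
    detD≈ : det D ≈ 1ℤ + p ^ n * y [mod p ^ suc n ]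
    detD≈ = ≈[mod]-reflexive (expand (p ^ n * y))
      where
      expand : ∀ x → (1ℤ + x) * 1ℤ - 0ℤ * 0ℤ ≡ 1ℤ + x
      expand = solve-∀
  part₂ : ∀ A → A ≋ I₂ [mod p ^ n ] → H A
  part₂ A A≋I =
    let A≈I = ≋[mod]⇒≈ₘ[mod] A≋I
        mkCong y detA≡1+yp^n = det-cong-≈ₘ[mod] A≈I
    in ∈H A y A≈I (≈[mod]-reflexive (trans detA≡1+yp^n (cong (λ i → 1ℤ + i) (ℤ.*-comm y (p ^ n)))))
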